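{- Let $\mathcal{C}$ be a cd-category in which every morphism $f$ has a minimal normalisation, denoted $m(f)$. Then for every morphism $f\colon X\to Y$ we have $m(\epsilon_Y\circ f)=\epsilon_Y\circ m(f)$.
   Context: A cd-category is a symmetric monoidal category $(\mathcal{C},\otimes,I)$ (symmetry $\sigma$) in which every object $X$ carries $\Delta_X\colon X\to X\otimes X$ and $\epsilon_X\colon X\to I$ forming a commutative comonoid, compatible with the tensor. For $f,g\colon X\to Y$, $g$ normalises $f$ if $f=(g\otimes(\epsilon_Y\circ f))\circ\Delta_X$; $g$ is a partial channel if it normalises itself. A minimal normalisation of $f$ is a partial channel $f'$ that normalises $f$ and such that every partial channel normalising $f$ also normalises $f'$ (it is unique when it exists). -}

module Defs where

open import Level using (Level; suc; _⊔_)
open import Relation.Binary using (Rel; IsEquivalence)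
open import Data.Product using (_×_)

record CDCategory (o ℓ e : Level) : Set (suc (o ⊔ ℓ ⊔ e)) where
  infixr 9 _∘_
  infix  4 _≈_
  infixr 10 _⊗₀_ _⊗₁_
  field
    Obj  : Set o
    _⇒_  : Obj → Obj → Set ℓ
    _≈_  : ∀ {A B} → Rel (A ⇒ B) e
    ≈-equiv : ∀ {A B} → IsEquivalence (_≈_ {A} {B})
    id   : ∀ {A} → A ⇒ A
    _∘_  : ∀ {A B C} → B ⇒ C → A ⇒ B → A ⇒ C
    assoc     : ∀ {A B C D} {f : A ⇒ B} {g : B ⇒ C} {h : C ⇒ D} →
                (h ∘ g) ∘ f ≈ h ∘ (g ∘ f)
    identityˡ : ∀ {A B} {f : A ⇒ B} → id ∘ f ≈ f
    identityʳ : ∀ {A B} {f : A ⇒ B} → f ∘ id ≈ f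
    ∘-resp-≈  : ∀ {A B C} {f h : B ⇒ C} {g i : A ⇒ B} →
                f ≈ h → g ≈ i → f ∘ g ≈ h ∘ i
    _⊗₀_ : Obj → Obj → Obj
    I    : Obj
    _⊗₁_ : ∀ {A B C D} → A ⇒ B → C ⇒ D → (A ⊗₀ C) ⇒ (B ⊗₀ D)
    ⊗-id : ∀ {A B} → id {A} ⊗₁ id {B} ≈ id
    ⊗-∘  : ∀ {A B C D E F} {f : B ⇒ C} {g : A ⇒ B} {h : E ⇒ F} {k : D ⇒ E} →
           (f ∘ g) ⊗₁ (h ∘ k) ≈ (f ⊗₁ h) ∘ (g ⊗₁ k)
    ⊗-resp-≈ : ∀ {A B C D} {f g : A ⇒ B} {h k : C ⇒ D} →
               f ≈ g → h ≈ k → f ⊗₁ h ≈ g ⊗₁ k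
    α⇒ : ∀ {A B C} → ((A ⊗₀ B) ⊗₀ C) ⇒ (A ⊗₀ (B ⊗₀ C))
    α⇐ : ∀ {A B C} → (A ⊗₀ (B ⊗₀ C)) ⇒ ((A ⊗₀ B) ⊗₀ C)
    α-isoˡ : ∀ {A B C} → α⇐ ∘ α⇒ {A} {B} {C} ≈ id
    α-isoʳ : ∀ {A B C} → α⇒ ∘ α⇐ {A} {B} {C} ≈ id
    α-natural : ∀ {A B C D E F} {f : A ⇒ D} {g : B ⇒ E} {h : C ⇒ F} →
                α⇒ ∘ ((f ⊗₁ g) ⊗₁ h) ≈ (f ⊗₁ (g ⊗₁ h)) ∘ α⇒
    unitˡ⇒ : ∀ {A} → (I ⊗₀ A) ⇒ A
    unitˡ⇐ : ∀ {A} → A ⇒ (I ⊗₀ A)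
    unitˡ-isoˡ : ∀ {A} → unitˡ⇐ ∘ unitˡ⇒ {A} ≈ id
    unitˡ-isoʳ : ∀ {A} → unitˡ⇒ ∘ unitˡ⇐ {A} ≈ id
    unitˡ-natural : ∀ {A B} {f : A ⇒ B} → unitˡ⇒ ∘ (id ⊗₁ f) ≈ f ∘ unitˡ⇒
    unitʳ⇒ : ∀ {A} → (A ⊗₀ I) ⇒ A
    unitʳ⇐ : ∀ {A} → A ⇒ (A ⊗₀ I)
    unitʳ-isoˡ : ∀ {A} → unitʳ⇐ ∘ unitʳ⇒ {A} ≈ id
    unitʳ-isoʳ : ∀ {A} → unitʳ⇒ ∘ unitʳ⇐ {A} ≈ id
    unitʳ-natural : ∀ {A B} {f : A ⇒ B} → unitʳ⇒ ∘ (f ⊗₁ id) ≈ f ∘ unitʳ⇒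
    triangle : ∀ {A B} → (id {A} ⊗₁ unitˡ⇒ {B}) ∘ α⇒ ≈ unitʳ⇒ ⊗₁ id
    pentagon : ∀ {A B C D} →
               (id {A} ⊗₁ α⇒ {B} {C} {D}) ∘ α⇒ ∘ (α⇒ ⊗₁ id) ≈ α⇒ ∘ α⇒
    σ : ∀ {A B} → (A ⊗₀ B) ⇒ (B ⊗₀ A)
    σ-inv : ∀ {A B} → σ ∘ σ {A} {B} ≈ id
    σ-natural : ∀ {A B C D} {f : A ⇒ B} {g : C ⇒ D} →
                σ ∘ (f ⊗₁ g) ≈ (g ⊗₁ f) ∘ σ
    hexagon : ∀ {A B C} →
              α⇒ ∘ σ {A} {B ⊗₀ C} ∘ α⇒ ≈ (id ⊗₁ σ) ∘ α⇒ ∘ (σ ⊗₁ id)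
    Δ : ∀ {A} → A ⇒ (A ⊗₀ A)
    ε : ∀ {A} → A ⇒ I
    Δ-counitˡ : ∀ {A} → unitˡ⇒ ∘ (ε ⊗₁ id) ∘ Δ {A} ≈ id
    Δ-counitʳ : ∀ {A} → unitʳ⇒ ∘ (id ⊗₁ ε) ∘ Δ {A} ≈ id
    Δ-coassoc : ∀ {A} → α⇒ ∘ (Δ ⊗₁ id) ∘ Δ {A} ≈ (id ⊗₁ Δ) ∘ Δ
    Δ-comm    : ∀ {A} → σ ∘ Δ {A} ≈ Δ
    Δ-⊗ : ∀ {A B} → Δ {A ⊗₀ B} ≈
          α⇐ ∘ (id ⊗₁ α⇒) ∘ (id ⊗₁ (σ ⊗₁ id)) ∘ (id ⊗₁ α⇐) ∘ α⇒ ∘ (Δ ⊗₁ Δ)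
    ε-⊗ : ∀ {A B} → ε {A ⊗₀ B} ≈ unitˡ⇒ ∘ (ε ⊗₁ ε)
    Δ-I : Δ {I} ≈ unitˡ⇐
    ε-I : ε {I} ≈ id

module _ {o ℓ e} (C : CDCategory o ℓ e) where
  open CDCategory C

  Normalises : ∀ {X Y} → X ⇒ Y → X ⇒ Y → Set e
  Normalises g f = f ≈ unitʳ⇒ ∘ (g ⊗₁ (ε ∘ f)) ∘ Δ

  PartialChannel : ∀ {X Y} → X ⇒ Y → Set e
  PartialChannel g = Normalises g g

  IsMinimalNormalisation : ∀ {X Y} → X ⇒ Y → X ⇒ Y → Set (ℓ ⊔ e)
  IsMinimalNormalisation f f' =
    PartialChannel f' × Normalises f' f ×
    (∀ g → PartialChannel g → Normalises g f → Normalises g f')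

{-# OPTIONS --safe #-}
module Submission where

-- Write a · s for a morphism a restricted along a scalar s : X ⇒ I, so
-- that g normalises f exactly when f ≈ g · (ε ∘ f). Scalars form a commutative
-- monoid under ·, and discarding commutes with restriction. Put e = ε ∘ m f and
-- n = m (ε ∘ f). Both are idempotent scalars; e is a partial channel normalising
-- ε ∘ f, so minimality of n gives n ≈ e · n. Conversely m f · n is a partial
-- channel normalising f, so minimality of m f gives m f ≈ (m f · n) · e, and
-- discarding yields e ≈ (e · n) · e ≈ e · n. Hence n ≈ e.

open import Defs
open import Level using (Level)
open import Data.Product using (_,_)
open import Relation.Binary using (Setoid; IsEquivalence)
import Relation.Binary.Reasoning.Setoid as SetoidReasoning

module Restriction {o ℓ r} (C : CDCategory o ℓ r) where
  open CDCategory C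

  homSetoid : Obj → Obj → Setoid ℓ r
  homSetoid A B = record { Carrier = A ⇒ B ; _≈_ = _≈_ ; isEquivalence = ≈-equiv }

  module _ {A B : Obj} where
    open IsEquivalence (≈-equiv {A} {B}) public
      using () renaming (refl to ≈-refl; sym to ≈-sym; trans to ≈-trans)
    open SetoidReasoning (homSetoid A B) public

  ∘-congˡ : ∀ {A B C} {f : B ⇒ C} {g h : A ⇒ B} → g ≈ h → f ∘ g ≈ f ∘ h
  ∘-congˡ = ∘-resp-≈ ≈-refl

  ∘-congʳ : ∀ {A B C} {f g : B ⇒ C} {h : A ⇒ B} → f ≈ g → f ∘ h ≈ g ∘ h
  ∘-congʳ p = ∘-resp-≈ p ≈-refl

  ⊗-∘-idʳ : ∀ {A B C D E F} {f : C ⇒ E} {g : B ⇒ C} {h : A ⇒ B} {k : D ⇒ F} →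
            (f ∘ g ∘ h) ⊗₁ k ≈ (f ⊗₁ id) ∘ (g ⊗₁ k) ∘ (h ⊗₁ id)
  ⊗-∘-idʳ = ≈-trans (⊗-resp-≈ ≈-refl (≈-sym (≈-trans identityˡ identityʳ)))
                    (≈-trans ⊗-∘ (∘-congˡ ⊗-∘))

  ⊗-∘-idˡ : ∀ {A B C D E F} {f : C ⇒ E} {g : B ⇒ C} {h : A ⇒ B} {k : D ⇒ F} →
            k ⊗₁ (f ∘ g ∘ h) ≈ (id ⊗₁ f) ∘ (k ⊗₁ g) ∘ (id ⊗₁ h)
  ⊗-∘-idˡ = ≈-trans (⊗-resp-≈ (≈-sym (≈-trans identityˡ identityʳ)) ≈-refl)
                    (≈-trans ⊗-∘ (∘-congˡ ⊗-∘))

  unitʳ∘unitˡ⇐ : unitʳ⇒ {I} ∘ unitˡ⇐ ≈ id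
  unitʳ∘unitˡ⇐ = begin
    unitʳ⇒ ∘ unitˡ⇐           ≈⟨ ∘-congˡ identityˡ ⟨
    unitʳ⇒ ∘ id ∘ unitˡ⇐      ≈⟨ ∘-congˡ (∘-resp-≈ ⊗-id Δ-I) ⟨
    unitʳ⇒ ∘ (id ⊗₁ id) ∘ Δ   ≈⟨ ∘-congˡ (∘-congʳ (⊗-resp-≈ ≈-refl ε-I)) ⟨
    unitʳ⇒ ∘ (id ⊗₁ ε) ∘ Δ    ≈⟨ Δ-counitʳ ⟩
    id                        ∎

  unitʳ∘unitˡ⇐∘unitˡ⇒ : unitʳ⇒ {I} ∘ unitˡ⇐ ∘ unitˡ⇒ ≈ unitˡ⇒
  unitʳ∘unitˡ⇐∘unitˡ⇒ = ≈-trans (≈-sym assoc) (≈-trans (∘-congʳ unitʳ∘unitˡ⇐) identityˡ)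

  unitʳ≈unitˡ : unitʳ⇒ {I} ≈ unitˡ⇒
  unitʳ≈unitˡ = begin
    unitʳ⇒                    ≈⟨ identityʳ ⟨
    unitʳ⇒ ∘ id               ≈⟨ ∘-congˡ unitˡ-isoˡ ⟨
    unitʳ⇒ ∘ unitˡ⇐ ∘ unitˡ⇒  ≈⟨ unitʳ∘unitˡ⇐∘unitˡ⇒ ⟩
    unitˡ⇒                    ∎

  unitʳ∘σ : unitʳ⇒ {I} ∘ σ ≈ unitʳ⇒
  unitʳ∘σ = begin
    unitʳ⇒ ∘ σ                     ≈⟨ identityʳ ⟨
    (unitʳ⇒ ∘ σ) ∘ id              ≈⟨ ∘-congˡ unitˡ-isoˡ ⟨
    (unitʳ⇒ ∘ σ) ∘ unitˡ⇐ ∘ unitˡ⇒  ≈⟨ ≈-trans assoc (∘-congˡ (≈-sym assoc)) ⟩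
    unitʳ⇒ ∘ (σ ∘ unitˡ⇐) ∘ unitˡ⇒  ≈⟨ ∘-congˡ (∘-congʳ σ∘unitˡ⇐) ⟩
    unitʳ⇒ ∘ unitˡ⇐ ∘ unitˡ⇒        ≈⟨ unitʳ∘unitˡ⇐∘unitˡ⇒ ⟩
    unitˡ⇒                         ≈⟨ unitʳ≈unitˡ ⟨
    unitʳ⇒                         ∎
    where
    σ∘unitˡ⇐ : σ ∘ unitˡ⇐ {I} ≈ unitˡ⇐
    σ∘unitˡ⇐ = ≈-trans (∘-congˡ (≈-sym Δ-I)) (≈-trans Δ-comm Δ-I)

  infixl 7 _·_
  _·_ : ∀ {X A} → X ⇒ A → X ⇒ I → X ⇒ A
  a · s = unitʳ⇒ ∘ (a ⊗₁ s) ∘ Δ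

  ·-cong : ∀ {X A} {a b : X ⇒ A} {s t : X ⇒ I} → a ≈ b → s ≈ t → a · s ≈ b · t
  ·-cong p q = ∘-congˡ (∘-congʳ (⊗-resp-≈ p q))

  ·-congˡ : ∀ {X A} {a : X ⇒ A} {s t : X ⇒ I} → s ≈ t → a · s ≈ a · t
  ·-congˡ = ·-cong ≈-refl

  ·-congʳ : ∀ {X A} {a b : X ⇒ A} {s : X ⇒ I} → a ≈ b → a · s ≈ b · s
  ·-congʳ p = ·-cong p ≈-refl

  ε∘scalar : ∀ {X} (s : X ⇒ I) → ε ∘ s ≈ s
  ε∘scalar s = ≈-trans (∘-congʳ ε-I) identityˡ

  ε∘· : ∀ {X A} (a : X ⇒ A) (s : X ⇒ I) → ε ∘ (a · s) ≈ (ε ∘ a) · s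
  ε∘· a s = begin
    ε ∘ unitʳ⇒ ∘ (a ⊗₁ s) ∘ Δ               ≈⟨ assoc ⟨
    (ε ∘ unitʳ⇒) ∘ (a ⊗₁ s) ∘ Δ             ≈⟨ ∘-congʳ unitʳ-natural ⟨
    (unitʳ⇒ ∘ (ε ⊗₁ id)) ∘ (a ⊗₁ s) ∘ Δ     ≈⟨ ≈-trans assoc (∘-congˡ (≈-sym assoc)) ⟩
    unitʳ⇒ ∘ ((ε ⊗₁ id) ∘ (a ⊗₁ s)) ∘ Δ     ≈⟨ ∘-congˡ (∘-congʳ ⊗-∘) ⟨
    unitʳ⇒ ∘ ((ε ∘ a) ⊗₁ (id ∘ s)) ∘ Δ      ≈⟨ ·-congˡ identityˡ ⟩
    (ε ∘ a) · s                             ∎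

  ·-comm : ∀ {X} (s t : X ⇒ I) → s · t ≈ t · s
  ·-comm s t = begin
    unitʳ⇒ ∘ (s ⊗₁ t) ∘ Δ        ≈⟨ ∘-congˡ (∘-congˡ Δ-comm) ⟨
    unitʳ⇒ ∘ (s ⊗₁ t) ∘ σ ∘ Δ    ≈⟨ ∘-congˡ (≈-trans (≈-sym assoc) (∘-congʳ (≈-sym σ-natural))) ⟩
    unitʳ⇒ ∘ (σ ∘ (t ⊗₁ s)) ∘ Δ  ≈⟨ ≈-trans (∘-congˡ assoc) (≈-sym assoc) ⟩
    (unitʳ⇒ ∘ σ) ∘ (t ⊗₁ s) ∘ Δ  ≈⟨ ∘-congʳ unitʳ∘σ ⟩
    unitʳ⇒ ∘ (t ⊗₁ s) ∘ Δ        ∎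

  ·-assoc : ∀ {X A} (a : X ⇒ A) (s t : X ⇒ I) → (a · s) · t ≈ a · (s · t)
  ·-assoc a s t = begin
    (a · s) · t
      ≈⟨ ∘-congˡ (∘-congʳ ⊗-∘-idʳ) ⟩
    unitʳ⇒ ∘ ((unitʳ⇒ ⊗₁ id) ∘ ((a ⊗₁ s) ⊗₁ t) ∘ (Δ ⊗₁ id)) ∘ Δ
      ≈⟨ ≈-trans (∘-congˡ (≈-trans assoc (∘-congˡ assoc))) (≈-sym assoc) ⟩
    (unitʳ⇒ ∘ (unitʳ⇒ ⊗₁ id)) ∘ ((a ⊗₁ s) ⊗₁ t) ∘ (Δ ⊗₁ id) ∘ Δ
      ≈⟨ ∘-congʳ triangleᴵ ⟨
    (unitʳ⇒ ∘ (id ⊗₁ unitʳ⇒) ∘ α⇒) ∘ ((a ⊗₁ s) ⊗₁ t) ∘ (Δ ⊗₁ id) ∘ Δ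
      ≈⟨ ≈-trans assoc (∘-congˡ (≈-trans assoc (∘-congˡ (≈-sym assoc)))) ⟩
    unitʳ⇒ ∘ (id ⊗₁ unitʳ⇒) ∘ (α⇒ ∘ ((a ⊗₁ s) ⊗₁ t)) ∘ (Δ ⊗₁ id) ∘ Δ
      ≈⟨ ∘-congˡ (∘-congˡ (≈-trans (∘-congʳ α-natural) assoc)) ⟩
    unitʳ⇒ ∘ (id ⊗₁ unitʳ⇒) ∘ (a ⊗₁ (s ⊗₁ t)) ∘ α⇒ ∘ (Δ ⊗₁ id) ∘ Δ
      ≈⟨ ∘-congˡ (∘-congˡ (∘-congˡ Δ-coassoc)) ⟩
    unitʳ⇒ ∘ (id ⊗₁ unitʳ⇒) ∘ (a ⊗₁ (s ⊗₁ t)) ∘ (id ⊗₁ Δ) ∘ Δ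
      ≈⟨ ∘-congˡ (≈-trans (∘-congˡ (≈-sym assoc)) (≈-sym assoc)) ⟩
    unitʳ⇒ ∘ ((id ⊗₁ unitʳ⇒) ∘ (a ⊗₁ (s ⊗₁ t)) ∘ (id ⊗₁ Δ)) ∘ Δ
      ≈⟨ ∘-congˡ (∘-congʳ ⊗-∘-idˡ) ⟨
    a · (s · t)
      ∎
    where
    triangleᴵ : ∀ {A} → unitʳ⇒ {A} ∘ (id ⊗₁ unitʳ⇒ {I}) ∘ α⇒ ≈ unitʳ⇒ ∘ (unitʳ⇒ ⊗₁ id)
    triangleᴵ = ∘-congˡ (≈-trans (∘-congʳ (⊗-resp-≈ ≈-refl unitʳ≈unitˡ)) triangle)

  idempotent⇒·-absorb : ∀ {X} {s : X ⇒ I} (t : X ⇒ I) → s · s ≈ s → s · (t · s) ≈ t · s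
  idempotent⇒·-absorb {s = s} t s·s≈s = begin
    s · (t · s)  ≈⟨ ·-congˡ (·-comm t s) ⟩
    s · (s · t)  ≈⟨ ·-assoc s s t ⟨
    (s · s) · t  ≈⟨ ·-congʳ s·s≈s ⟩
    s · t        ≈⟨ ·-comm s t ⟩
    t · s        ∎

  Normalises⇒ε∘ : ∀ {X Y} {g f : X ⇒ Y} → Normalises C g f → Normalises C (ε ∘ g) (ε ∘ f)
  Normalises⇒ε∘ {g = g} {f} f≈g·εf = begin
    ε ∘ f                  ≈⟨ ∘-congˡ f≈g·εf ⟩
    ε ∘ (g · (ε ∘ f))      ≈⟨ ε∘· g (ε ∘ f) ⟩
    (ε ∘ g) · (ε ∘ f)      ≈⟨ ·-congˡ (ε∘scalar (ε ∘ f)) ⟨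
    (ε ∘ g) · (ε ∘ ε ∘ f)  ∎

  Normalises-scalar : ∀ {X} {s t : X ⇒ I} → Normalises C s t → t ≈ s · t
  Normalises-scalar {t = t} t≈s·εt = ≈-trans t≈s·εt (·-congˡ (ε∘scalar t))

  ·-PartialChannel : ∀ {X A} {p : X ⇒ A} {s : X ⇒ I} →
                     PartialChannel C p → PartialChannel C s → PartialChannel C (p · s)
  ·-PartialChannel {p = p} {s} p≈p·εp s-pc = ≈-sym (begin
    (p · s) · (ε ∘ (p · s))  ≈⟨ ·-congˡ (ε∘· p s) ⟩
    (p · s) · ((ε ∘ p) · s)  ≈⟨ ·-assoc p s _ ⟩
    p · (s · ((ε ∘ p) · s))  ≈⟨ ·-congˡ (idempotent⇒·-absorb _ s·s≈s) ⟩
    p · ((ε ∘ p) · s)        ≈⟨ ·-assoc p _ s ⟨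
    (p · (ε ∘ p)) · s        ≈⟨ ·-congʳ p≈p·εp ⟨
    p · s                    ∎)
    where
    s·s≈s : s · s ≈ s
    s·s≈s = ≈-sym (Normalises-scalar s-pc)

  ·-Normalises : ∀ {X Y} {g f : X ⇒ Y} {s : X ⇒ I} →
                 Normalises C g f → Normalises C s (ε ∘ f) → Normalises C (g · s) f
  ·-Normalises {g = g} {f} {s} f≈g·εf s-norm = begin
    f                  ≈⟨ f≈g·εf ⟩
    g · (ε ∘ f)        ≈⟨ ·-congˡ (Normalises-scalar s-norm) ⟩
    g · (s · (ε ∘ f))  ≈⟨ ·-assoc g s (ε ∘ f) ⟨
    (g · s) · (ε ∘ f)  ∎

  minimalNormalisation-ε∘ : ∀ {X Y} {f f' : X ⇒ Y} {n : X ⇒ I} →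
                            IsMinimalNormalisation C f f' →
                            IsMinimalNormalisation C (ε ∘ f) n → n ≈ ε ∘ f'
  minimalNormalisation-ε∘ {X} {f = f} {f'} {n}
                          (f'-pc , f'-norm , f'-min) (n-pc , n-norm , n-min) = begin
    n                 ≈⟨ Normalises-scalar (n-min e (Normalises⇒ε∘ f'-pc) (Normalises⇒ε∘ f'-norm)) ⟩
    e · n             ≈⟨ ·-comm e n ⟩
    n · e             ≈⟨ idempotent⇒·-absorb n e·e≈e ⟨
    e · (n · e)       ≈⟨ ·-assoc e n e ⟨
    (e · n) · e       ≈⟨ ≈-trans (ε∘· (f' · n) e) (·-congʳ (ε∘· f' n)) ⟨
    ε ∘ (f' · n · e)  ≈⟨ ∘-congˡ (f'-min (f' · n) f'·n-pc f'·n-norm) ⟨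
    e                 ∎
    where
    e : X ⇒ I
    e = ε ∘ f'
    e·e≈e : e · e ≈ e
    e·e≈e = ≈-sym (Normalises-scalar (Normalises⇒ε∘ f'-pc))
    f'·n-pc : PartialChannel C (f' · n)
    f'·n-pc = ·-PartialChannel f'-pc n-pc
    f'·n-norm : Normalises C (f' · n) f
    f'·n-norm = ·-Normalises f'-norm n-norm

lemmaB6 : ∀ {o ℓ e : Level} (C : CDCategory o ℓ e) →
            let open CDCategory C in
            (m : ∀ {X Y} → X ⇒ Y → X ⇒ Y) →
            (∀ {X Y} (f : X ⇒ Y) → IsMinimalNormalisation C f (m f)) →
            ∀ {X Y} (f : X ⇒ Y) → m (ε ∘ f) ≈ ε ∘ m f
lemmaB6 C m minimal f = minimalNormalisation-ε∘ (minimal f) (minimal (ε ∘ f))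
  where open CDCategory C
        open Restriction C
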